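{- Let $n\ge1$ and let $s\in[n+1]^{n+1}$ be such that $(\mathcal{P}_{n+1},s)$ is a prime parking function with $s_1=1$ and $s_i\le i-1$ for $2\le i\le n+1$. Let $\sigma=\sigma_1\sigma_2\cdots\sigma_n\in\mathfrak{S}_n$ be the permutation obtained by reading the labels of the path $\alpha((\mathcal{P}_{n+1},s))$ traveling away from the root ($\sigma_1$ is the label of the child of the root). Then for $2\le i\le n+1$, \[ s_i = |\{j > n+2-i : \sigma_j < \sigma_{n+2-i}\}| + 1. \]
   Context: Rooted trees have edges oriented towards the root; $(u,v)$ denotes the edge $u\to v$. Given $p\in[m]^m$ and a rooted tree on $[m]$, drivers $1,\dots,m$ arrive in order; driver $i$ goes to $p_i$ and parks there if unoccupied; otherwise she travels towards the root and parks at the first unoccupied vertex (crossing the edges on the way); if none, she leaves. The pair is a parking function if all drivers park; it is prime if for every non-root $v$, the number of $i$ with $p_i$ in the subtree $T_v$ of vertices having a directed path to $v$ exceeds $|T_v|$. $\mathcal{P}_{m}$ is the path $1\to2\to\cdots\to m$ with root $m$. An ordered tree has linearly ordered children; post-order labeling labels vertices $1,\dots,m$ in post-order traversal (children left to right). $\mathcal{SRP}_m$ is the set of pairs $(\mathcal{T},p)$, $\mathcal{T}$ an ordered tree on $[m]$ labeled in post-order, $p\in[m]^m$, with $(\mathcal{T},p)$ a prime parking function and such that for siblings $u,v$ with parent $w$, $v$ is right of $u$ iff edge $(v,w)$ is crossed by a driver before $(u,w)$ is. The pair $(\mathcal{P}_{n+1},s)$ lies in $\mathcal{SRP}_{n+1}$,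 and $\alpha((\mathcal{P}_{n+1},s))$ is a path with non-root vertices labeled by $[n]$. The map $\alpha$ from $\mathcal{SRP}_m$ to ordered trees on $m$ vertices with non-root vertices labeled by $[m-1]$ is defined recursively. If $m=1$, $\alpha$ gives a single unlabeled vertex. If $m\ge2$, given $(\mathcal{T},p)\in\mathcal{SRP}_m$: park only drivers $1,\dots,m-1$ and call an edge highlighted if one of them crosses it. Delete all non-highlighted edges and the root $m$ (the non-highlighted edges lie on the path from $p_m$ to the root). The remaining components $\mathcal{T}_1,\dots,\mathcal{T}_r$ are indexed in the order they occur along the path from vertex $p_m$ to the root (so $p_m\in\mathcal{T}_1$). Mark the vertex $p_m$ in $\mathcal{T}_1$, and for $i\ge2$ mark the vertex $v\in\mathcal{T}_i$ such that the deleted edge $(u,v)$ has $u$ the root of $\mathcal{T}_{i-1}$. Let $p^{(i)}$ be the subsequence of $(p_1,\dots,p_{m-1})$ of entries lying in $\mathcal{T}_i$ and $A_i=\{j\in[m-1]:p_j\in\mathcal{T}_i\}$ (so $|A_i|=|\mathcal{T}_i|$). If the marked vertex is the $k$-th smallest label of $\mathcal{T}_i$, mark the $k$-th smallest element of $A_i$. Relabel $\mathcal{T}_i$ and $p^{(i)}$ order-preservingly by $[|\mathcal{T}_i|]$ (keeping the inherited sibling order) to get $(\overline{\mathcal{T}}_i,\overline{p}^{(i)})\in\mathcal{SRP}_{|\mathcal{T}_i|}$; compute $Q_i=\alpha((\overline{\mathcal{T}}_i,\overline{p}^{(i)}))$; label the root of $Q_i$ by the marked element of $A_i$ and its non-root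 vertices (labeled by $[|\mathcal{T}_i|-1]$) by the unmarked elements of $A_i$, preserving relative order, obtaining $P_i$. Then $\alpha((\mathcal{T},p))$ is a new unlabeled root whose children, from left to right, are the roots of $P_1,\dots,P_r$. -}

module Defs where

open import Data.Nat using (ℕ; zero; suc; _+_; _∸_; _≤ᵇ_; _<ᵇ_; _≡ᵇ_)
open import Data.Bool using (Bool; true; false; if_then_else_; _∧_; not)
open import Data.List using (List; []; _∷_; map; length; take; zip)
open import Data.Bool.ListAction using (any; all)
open import Data.Maybe using (Maybe; just; nothing; is-just)
open import Data.Product using (_×_; _,_)

-- Ordered trees with natural-number labels.  Children are listed left
-- to right.  An unlabeled root (as produced by α) carries the dummy
-- label 0 (all genuine labels are ≥ 1).

data OTree : Set where
  node : ℕ → List OTree → OTree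

chain : List ℕ → List OTree
chain []       = []
chain (x ∷ xs) = node x (chain xs) ∷ []

pathTree : List ℕ → OTree
pathTree σ = node 0 (chain σ)

range : ℕ → ℕ → List ℕ
range a zero    = []
range a (suc k) = a ∷ range (suc a) k

interval : ℕ → ℕ → List ℕ
interval a b = range a (suc b ∸ a)

-- at xs i = i-th entry (1-based); 0 if out of range
at : List ℕ → ℕ → ℕ
at []       _             = 0
at (x ∷ xs) zero          = 0
at (x ∷ xs) (suc zero)    = x
at (x ∷ xs) (suc (suc k)) = at xs (suc k)

removeAt : List ℕ → ℕ → List ℕ
removeAt []       _             = []
removeAt (x ∷ xs) zero          = x ∷ xs
removeAt (x ∷ xs) (suc zero)    = xs
removeAt (x ∷ xs) (suc (suc k)) = x ∷ removeAt xs (suc k)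

filterB : {A : Set} → (A → Bool) → List A → List A
filterB P []       = []
filterB P (x ∷ xs) = if P x then x ∷ filterB P xs else filterB P xs

countB : {A : Set} → (A → Bool) → List A → ℕ
countB P xs = length (filterB P xs)

memb : ℕ → List ℕ → Bool
memb v = any (v ≡ᵇ_)

-- Parking on the path 𝒫ₘ : 1 → 2 → ⋯ → m (root m).

firstFree : List ℕ → List ℕ → Maybe ℕ
firstFree occ []       = nothing
firstFree occ (v ∷ vs) = if memb v occ then firstFree occ vs else just v

-- the spot where a driver preferring a parks (nothing = she leaves)
spotOf : ℕ → List ℕ → ℕ → Maybe ℕ
spotOf m occ a = firstFree occ (interval a m)

parkStep : ℕ → List ℕ → Maybe ℕ → List ℕ
parkStep m occ nothing  = occ
parkStep m occ (just v) = v ∷ occ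

parkAll : ℕ → List ℕ → List ℕ → List (Maybe ℕ)
parkAll m []       occ = []
parkAll m (a ∷ as) occ =
  spotOf m occ a ∷ parkAll m as (parkStep m occ (spotOf m occ a))

IsParkingPath : ℕ → List ℕ → Set
IsParkingPath m p = all is-just (parkAll m p []) ≡ true
  where open import Relation.Binary.PropositionalEquality using (_≡_)

-- (𝒫ₘ , p) is prime: for every non-root v, the subtree T_v = {1,…,v}
-- receives more than |T_v| = v preferences.
IsPrimePath : ℕ → List ℕ → Set
IsPrimePath m p = (v : ℕ) → 1 ≤ v → v < m → v < countB (λ x → x ≤ᵇ v) p
  where open import Data.Nat using (_≤_; _<_)

-- the last vertex reached by a driver (her parking spot, or the root m
-- if she leaves); she crosses the edges (v , v+1) with a ≤ v < end
endOf : ℕ → Maybe ℕ → ℕ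
endOf m nothing  = m
endOf m (just v) = v

highlighted : ℕ → List ℕ → ℕ → Bool
highlighted m drivers v =
  any (λ { (a , r) → (a ≤ᵇ v) ∧ (v <ᵇ endOf m r) })
      (zip drivers (parkAll m drivers []))

-- connected components (intervals [a , b]) of the non-root vertices
-- 1 … m-1 after deleting non-highlighted edges, in order along the path
compsGo : (ℕ → Bool) → ℕ → List ℕ → List (ℕ × ℕ)
compsGo hl a []            = []
compsGo hl a (v ∷ [])      = (a , v) ∷ []
compsGo hl a (v ∷ w ∷ rest) =
  if hl v then compsGo hl a (w ∷ rest) else (a , v) ∷ compsGo hl w (w ∷ rest)

mutual
  mapLabels : (ℕ → ℕ) → OTree → OTree
  mapLabels f (node x ts) = node (f x) (mapLabelsL f ts)

  mapLabelsL : (ℕ → ℕ) → List OTree → List OTree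
  mapLabelsL f []       = []
  mapLabelsL f (t ∷ ts) = mapLabels f t ∷ mapLabelsL f ts

relabel : ℕ → (ℕ → ℕ) → OTree → OTree
relabel r f (node _ ts) = node r (mapLabelsL f ts)

-- The map α restricted to inputs (𝒫ₘ , p) (paths labelled in post-order,
-- which is 1 → 2 → ⋯ → m).  All components 𝒯ᵢ arising in the recursion
-- are again paths, so this restriction is closed under the recursion.
-- The first argument is fuel (≥ m suffices).

alphaF : ℕ → ℕ → List ℕ → OTree
alphaF zero          m             p = node 0 []
alphaF (suc f)       zero          p = node 0 []
alphaF (suc f)       (suc zero)    p = node 0 []
alphaF (suc f) m@(suc (suc k)) p = node 0 (build (compsGo hl 1 (interval 1 m')))
  where
    m'      = suc k
    drivers = take m' p
    pm      = at p m
    hl      = highlighted m drivers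
    -- the component [a , b] with marked vertex of rank kk
    piece : ℕ → ℕ × ℕ → OTree
    piece kk (a , b) =
      let inT  = λ x → (a ≤ᵇ x) ∧ (x ≤ᵇ b)
          size = suc b ∸ a
          A    = filterB (λ j → inT (at p j)) (interval 1 m')
          sub  = map (λ x → x ∸ (a ∸ 1)) (filterB inT drivers)
          Q    = alphaF f size sub
          rest = removeAt A kk
      in relabel (at A kk) (at rest) Q
    build : List (ℕ × ℕ) → List OTree
    build []                = []
    build ((a , b) ∷ cs)    = piece (suc (pm ∸ a)) (a , b) ∷ map (piece 1) cs

α : ℕ → List ℕ → OTree
α m p = alphaF m m p

-- Because s₁ = 1 and sᵢ ≤ i − 1, the first n drivers park at 1, …, n in
-- order and driver v + 1 crosses the edge (v , v + 1) for every v < n.  So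
-- α sees a single component, the path 1 → ⋯ → n with marked vertex sₙ₊₁,
-- whose recursive input is (𝒫ₙ , s₁ ⋯ sₙ).  Hence σ = sₙ₊₁ · ι(σ′), where σ′
-- is the path of the prefix and ι punches the value sₙ₊₁ into [n − 1].  By
-- induction σ′ is a permutation of [n − 1]; thus exactly sₙ₊₁ − 1 entries of
-- σ lie below σ₁ = sₙ₊₁, and since ι preserves relative order the remaining
-- inversion counts of σ are those of σ′.
module Submission where

open import Defs
open import Data.Nat using (ℕ; suc; _∸_; _≤_; _<ᵇ_)
open import Data.List using (List; length)
open import Data.List.Relation.Unary.All using (All)
open import Data.Product using (_×_; ∃)
open import Relation.Binary.PropositionalEquality using (_≡_)

open import Data.Nat using (zero; _+_; _<_; _≤ᵇ_; _≡ᵇ_; _⊓_; z≤n; s≤s; pred)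
open import Data.Nat.Properties
open import Data.Bool using (Bool; true; false; T; if_then_else_; _∧_; _∨_)
open import Data.Bool.Properties using (∨-zeroʳ)
open import Data.Bool.ListAction using (any)
open import Data.List using ([]; _∷_; map; take; drop; zip)
open import Data.List.Properties using (map-id; map-cong-local; length-map; length-take; drop-map)
open import Data.List.Relation.Unary.All using ([]; _∷_)
import Data.List.Relation.Unary.All as All
open import Data.List.Relation.Unary.All.Properties using (map⁺)
open import Data.Maybe using (Maybe; just)
open import Data.Product using (_,_; proj₁; proj₂)
open import Data.Sum using (inj₁; inj₂)
open import Data.Unit using (tt)
open import Relation.Nullary using (¬_; yes; no; contradiction)
open import Relation.Binary.PropositionalEquality using (refl; sym; trans; cong; cong₂; subst; module ≡-Reasoning)

T⇒≡true : ∀ {b} → T b → b ≡ true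
T⇒≡true {true} _ = refl

¬T⇒≡false : ∀ {b} → ¬ T b → b ≡ false
¬T⇒≡false {false} _ = refl
¬T⇒≡false {true} ¬t = contradiction tt ¬t

<ᵇ-true : ∀ {m n} → m < n → (m <ᵇ n) ≡ true
<ᵇ-true m<n = T⇒≡true (<⇒<ᵇ m<n)

<ᵇ-false : ∀ {m n} → n ≤ m → (m <ᵇ n) ≡ false
<ᵇ-false {m} {n} n≤m = ¬T⇒≡false (λ t → ≤⇒≯ n≤m (<ᵇ⇒< m n t))

≤ᵇ-true : ∀ {m n} → m ≤ n → (m ≤ᵇ n) ≡ true
≤ᵇ-true m≤n = T⇒≡true (≤⇒≤ᵇ m≤n)

≡ᵇ-refl : ∀ n → (n ≡ᵇ n) ≡ true
≡ᵇ-refl n = T⇒≡true (≡⇒≡ᵇ n n refl)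

≡ᵇ-false : ∀ m n → ¬ m ≡ n → (m ≡ᵇ n) ≡ false
≡ᵇ-false m n m≢n = ¬T⇒≡false (λ t → m≢n (≡ᵇ⇒≡ m n t))

1+m∸n≡1+[m∸n] : ∀ {m n} → n ≤ m → suc m ∸ n ≡ suc (m ∸ n)
1+m∸n≡1+[m∸n] = +-∸-assoc 1

at-take : ∀ n (xs : List ℕ) i → i ≤ n → at (take n xs) i ≡ at xs i
at-take zero [] i _ = refl
at-take zero (x ∷ xs) zero _ = refl
at-take (suc n) [] i _ = refl
at-take (suc n) (x ∷ xs) zero _ = refl
at-take (suc n) (x ∷ xs) (suc zero) _ = refl
at-take (suc n) (x ∷ xs) (suc (suc i)) (s≤s i≤n) = at-take n xs (suc i) i≤n

at-map : ∀ (f : ℕ → ℕ) → f 0 ≡ 0 → ∀ xs q → at (map f xs) q ≡ f (at xs q)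
at-map f f0≡0 [] q = sym f0≡0
at-map f f0≡0 (x ∷ xs) zero = sym f0≡0
at-map f f0≡0 (x ∷ xs) (suc zero) = refl
at-map f f0≡0 (x ∷ xs) (suc (suc q)) = at-map f f0≡0 xs (suc q)

at-range : ∀ a l j → j < l → at (range a l) (suc j) ≡ a + j
at-range a (suc l) zero _ = sym (+-identityʳ a)
at-range a (suc l) (suc j) (s≤s j<l) = trans (at-range (suc a) l j j<l) (sym (+-suc a j))

All⇒at : ∀ {P : ℕ → Set} {xs} → All P xs → ∀ i → 1 ≤ i → i ≤ length xs → P (at xs i)
All⇒at (px ∷ _) (suc zero) _ _ = px
All⇒at (_ ∷ pxs) (suc (suc i)) _ (s≤s i<n) = All⇒at pxs (suc i) (s≤s z≤n) i<n

at⇒All : ∀ {P : ℕ → Set} xs → (∀ i → 1 ≤ i → i ≤ length xs → P (at xs i)) → All P xs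
at⇒All [] _ = []
at⇒All (x ∷ xs) h =
  h 1 (s≤s z≤n) (s≤s z≤n) ∷ at⇒All xs (λ { (suc i) _ i≤n → h (suc (suc i)) (s≤s z≤n) (s≤s i≤n) })

All-range : ∀ {P : ℕ → Set} a l → (∀ j → a ≤ j → j < a + l → P j) → All P (range a l)
All-range a zero _ = []
All-range a (suc l) h =
  h a ≤-refl (subst (a <_) (sym (+-suc a l)) (s≤s (m≤m+n a l)))
  ∷ All-range (suc a) l (λ j a<j j<a+l → h j (<⇒≤ a<j) (subst (j <_) (sym (+-suc a l)) j<a+l))

map-at-tail : ∀ x (xs : List ℕ) a l → map (at (x ∷ xs)) (range (suc (suc a)) l) ≡ map (at xs) (range (suc a) l)
map-at-tail x xs a zero = refl
map-at-tail x xs a (suc l) = cong (at xs (suc a) ∷_) (map-at-tail x xs (suc a) l)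

map-at-range : ∀ (xs : List ℕ) q → map (at xs) (range (suc q) (length xs ∸ q)) ≡ drop q xs
map-at-range [] zero = refl
map-at-range [] (suc q) = refl
map-at-range (x ∷ xs) zero = cong (x ∷_) (trans (map-at-tail x xs 0 (length xs)) (map-at-range xs 0))
map-at-range (x ∷ xs) (suc q) = trans (map-at-tail x xs q (length xs ∸ q)) (map-at-range xs q)

filterB-all : ∀ {A : Set} (P : A → Bool) xs → All (λ x → P x ≡ true) xs → filterB P xs ≡ xs
filterB-all P [] [] = refl
filterB-all P (x ∷ xs) (px ∷ pxs) rewrite px = cong (x ∷_) (filterB-all P xs pxs)

countB-map : ∀ (P : ℕ → Bool) (f : ℕ → ℕ) xs → countB P (map f xs) ≡ countB (λ x → P (f x)) xs
countB-map P f [] = refl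
countB-map P f (x ∷ xs) with P (f x)
... | true = cong suc (countB-map P f xs)
... | false = countB-map P f xs

countB-cong : ∀ {P Q : ℕ → Bool} xs → (∀ x → P x ≡ Q x) → countB P xs ≡ countB Q xs
countB-cong [] _ = refl
countB-cong {P} {Q} (x ∷ xs) P≗Q rewrite P≗Q x with Q x
... | true = cong suc (countB-cong xs P≗Q)
... | false = countB-cong xs P≗Q

-- Parking when driver i prefers a spot at most i

-- the occupied set after drivers park at 1, …, c, in the order parkStep builds it
occupied : ℕ → List ℕ
occupied zero = []
occupied (suc c) = suc c ∷ occupied c

memb-occupied : ∀ v c → 1 ≤ v → v ≤ c → memb v (occupied c) ≡ true
memb-occupied zero zero () _
memb-occupied (suc v) zero _ ()
memb-occupied v (suc c) 1≤v v≤c with m≤n⇒m<n∨m≡n v≤c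
... | inj₂ refl rewrite ≡ᵇ-refl (suc c) = refl
... | inj₁ (s≤s v≤c′) rewrite memb-occupied v c 1≤v v≤c′ = ∨-zeroʳ _

memb-unoccupied : ∀ v c → c < v → memb v (occupied c) ≡ false
memb-unoccupied v zero _ = refl
memb-unoccupied v (suc c) c<v
  rewrite ≡ᵇ-false v (suc c) (λ v≡c → <-irrefl (sym v≡c) c<v)
        | memb-unoccupied v c (<-trans (n<1+n c) c<v) = refl

firstFree-occupied : ∀ d x c → 1 ≤ x → x ≤ suc c → suc c < x + d →
  firstFree (occupied c) (range x d) ≡ just (suc c)
firstFree-occupied zero x c _ x≤c c<x+0 =
  contradiction (subst (_≤ suc c) (sym (+-identityʳ x)) x≤c) (<⇒≱ c<x+0)
firstFree-occupied (suc d) x c 1≤x x≤c c<x+d with m≤n⇒m<n∨m≡n x≤c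
... | inj₂ refl rewrite memb-unoccupied (suc c) c (n<1+n c) = refl
... | inj₁ (s≤s x≤c′) rewrite memb-occupied x c 1≤x x≤c′ =
  firstFree-occupied d (suc x) c (s≤s z≤n) (s≤s x≤c′) (subst (suc c <_) (+-suc x d) c<x+d)

spotOf-occupied : ∀ m c x → 1 ≤ x → x ≤ suc c → suc c ≤ m → spotOf m (occupied c) x ≡ just (suc c)
spotOf-occupied m c x 1≤x x≤c c<m = firstFree-occupied (suc m ∸ x) x c 1≤x x≤c
  (subst (suc c <_) (sym (m+[n∸m]≡n (≤-trans x≤c (≤-trans c<m (n≤1+n m))))) (s≤s c<m))

parkAll-staircase : ∀ m c (xs : List ℕ) → c + length xs ≤ m →
  (∀ i → 1 ≤ i → i ≤ length xs → 1 ≤ at xs i × at xs i ≤ c + i) →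
  parkAll m xs (occupied c) ≡ map just (range (suc c) (length xs))
parkAll-staircase m c [] _ _ = refl
parkAll-staircase m c (x ∷ xs) c+l≤m h
  rewrite spotOf-occupied m c x (proj₁ (h 1 (s≤s z≤n) (s≤s z≤n)))
            (subst (x ≤_) (+-comm c 1) (proj₂ (h 1 (s≤s z≤n) (s≤s z≤n))))
            (≤-trans (s≤s (m≤m+n c (length xs))) (subst (_≤ m) (+-suc c (length xs)) c+l≤m))
  = cong (just (suc c) ∷_) (parkAll-staircase m (suc c) xs c+1+l≤m h′)
  where
  c+1+l≤m : suc c + length xs ≤ m
  c+1+l≤m = subst (_≤ m) (+-suc c (length xs)) c+l≤m
  h′ : ∀ i → 1 ≤ i → i ≤ length xs → 1 ≤ at xs i × at xs i ≤ suc c + i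
  h′ (suc i) _ i<l with h (suc (suc i)) (s≤s z≤n) (s≤s i<l)
  ... | 1≤x , x≤c+i = 1≤x , subst (at xs (suc i) ≤_) (+-suc c (suc i)) x≤c+i

-- F abstracts the anonymous pattern-lambda inside the definition of highlighted.
any-crossing : ∀ m v {F : ℕ × Maybe ℕ → Bool} → (∀ a r → F (a , r) ≡ ((a ≤ᵇ v) ∧ (v <ᵇ endOf m r))) →
  ∀ d b (xs : List ℕ) l → v ≡ d + b → suc d ≤ length xs → suc d ≤ l → at xs (suc d) ≤ v →
  any F (zip xs (map just (range (suc b) l))) ≡ true
any-crossing m v F-spec zero b (x ∷ xs) (suc l) v≡b _ _ x≤v
  rewrite F-spec x (just (suc b)) | ≤ᵇ-true x≤v | <ᵇ-true {v} {suc b} (s≤s (≤-reflexive v≡b)) = refl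
any-crossing m v {F} F-spec (suc d) b (x ∷ xs) (suc l) v≡d+b (s≤s d<n) (s≤s d<l) x≤v =
  trans (cong (F (x , just (suc b)) ∨_)
               (any-crossing m v F-spec d (suc b) xs l (trans v≡d+b (sym (+-suc d b))) d<n d<l x≤v))
        (∨-zeroʳ _)

highlighted-staircase : ∀ m (xs : List ℕ) v → parkAll m xs [] ≡ map just (range 1 (length xs)) →
  suc v ≤ length xs → at xs (suc v) ≤ v → highlighted m xs v ≡ true
highlighted-staircase m xs v parks v<n x≤v rewrite parks =
  any-crossing m v (λ a r → refl) v 0 xs (length xs) (sym (+-identityʳ v)) v<n v<n x≤v

compsGo-connected : ∀ (hl : ℕ → Bool) a j b → (∀ v → b ≤ v → v < b + j → hl v ≡ true) →
  compsGo hl a (range b (suc j)) ≡ (a , b + j) ∷ []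
compsGo-connected hl a zero b _ rewrite +-identityʳ b = refl
compsGo-connected hl a (suc j) b hl-all
  rewrite hl-all b ≤-refl (subst (b <_) (sym (+-suc b j)) (s≤s (m≤m+n b j))) =
  trans (compsGo-connected hl a j (suc b) hl-all′) (cong (λ e → (a , e) ∷ []) (sym (+-suc b j)))
  where
  hl-all′ : ∀ v → suc b ≤ v → v < suc b + j → hl v ≡ true
  hl-all′ v b<v v<b+j = hl-all v (<⇒≤ b<v) (subst (v <_) (sym (+-suc b j)) v<b+j)

record Subdiagonal (n : ℕ) (s : List ℕ) : Set where
  field
    length≡ : length s ≡ suc n
    first≡1 : at s 1 ≡ 1
    bounded : ∀ i → 2 ≤ i → i ≤ suc n → 1 ≤ at s i × at s i ≤ i ∸ 1

Subdiagonal-take : ∀ k s → Subdiagonal (suc k) s → Subdiagonal k (take (suc k) s)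
Subdiagonal-take k s g = record
  { length≡ = trans (length-take (suc k) s)
                    (trans (cong (suc k ⊓_) length≡) (m≤n⇒m⊓n≡m (n≤1+n (suc k))))
  ; first≡1 = trans (at-take (suc k) s 1 (s≤s z≤n)) first≡1
  ; bounded = λ i 2≤i i≤k → subst (λ x → 1 ≤ x × x ≤ i ∸ 1) (sym (at-take (suc k) s i i≤k))
                                  (bounded i 2≤i (≤-trans i≤k (n≤1+n _)))
  }
  where open Subdiagonal g

Subdiagonal-≤index : ∀ {n s} → Subdiagonal n s → ∀ i → 1 ≤ i → i ≤ suc n → 1 ≤ at s i × at s i ≤ i
Subdiagonal-≤index g (suc zero) _ _ rewrite Subdiagonal.first≡1 g = ≤-refl , ≤-refl
Subdiagonal-≤index g (suc (suc i)) _ i≤n with Subdiagonal.bounded g (suc (suc i)) (s≤s (s≤s z≤n)) i≤n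
... | 1≤x , x≤i = 1≤x , ≤-trans x≤i (n≤1+n _)

Subdiagonal-bounded : ∀ {k s} → Subdiagonal (suc k) s → ∀ j → 1 ≤ j → j ≤ suc (suc k) → 1 ≤ at s j × at s j ≤ suc k
Subdiagonal-bounded g (suc zero) _ _ rewrite Subdiagonal.first≡1 g = ≤-refl , s≤s z≤n
Subdiagonal-bounded g (suc (suc j)) _ j≤k with Subdiagonal.bounded g (suc (suc j)) (s≤s (s≤s z≤n)) j≤k
... | 1≤x , x≤j = 1≤x , ≤-trans x≤j (≤-pred j≤k)

Subdiagonal-last : ∀ {k s} → Subdiagonal (suc k) s → 1 ≤ at s (suc (suc k)) × at s (suc (suc k)) ≤ suc k
Subdiagonal-last g = Subdiagonal-bounded g _ (s≤s z≤n) ≤-refl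

highlighted-prefix : ∀ k s → Subdiagonal (suc k) s →
  ∀ v → 1 ≤ v → v < 1 + k → highlighted (suc (suc k)) (take (suc k) s) v ≡ true
highlighted-prefix k s g v 1≤v v<1+k =
  highlighted-staircase (suc (suc k)) s′ v parks (subst (suc v ≤_) (sym length≡) (s≤s (≤-pred v<1+k)))
    (subst (_≤ v) (sym (at-take (suc k) s (suc v) (s≤s (≤-pred v<1+k))))
           (proj₂ (Subdiagonal.bounded g (suc v) (s≤s 1≤v) (s≤s (≤-trans (≤-pred v<1+k) (n≤1+n k))))))
  where
  s′ = take (suc k) s
  g′ = Subdiagonal-take k s g
  open Subdiagonal g′ using (length≡)
  parks : parkAll (suc (suc k)) s′ [] ≡ map just (range 1 (length s′))
  parks = parkAll-staircase (suc (suc k)) 0 s′ (subst (_≤ suc (suc k)) (sym length≡) (n≤1+n _))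
            (λ i 1≤i i≤l → Subdiagonal-≤index g′ i 1≤i (subst (i ≤_) length≡ i≤l))

punchIn : ℕ → ℕ → ℕ
punchIn c x = if x <ᵇ c then x else suc x

punchIn-suc : ∀ c x → suc (punchIn c x) ≡ punchIn (suc c) (suc x)
punchIn-suc c x with x <ᵇ c
... | true = refl
... | false = refl

punchIn-bounded : ∀ c k x → 1 ≤ x → x ≤ k → 1 ≤ punchIn c x × punchIn c x ≤ suc k
punchIn-bounded c k x 1≤x x≤k with x <ᵇ c
... | true = 1≤x , ≤-trans x≤k (n≤1+n k)
... | false = s≤s z≤n , s≤s x≤k

punchIn-<ᵇ-below : ∀ c t y → t ≤ c → (punchIn c y <ᵇ t) ≡ (y <ᵇ t)
punchIn-<ᵇ-below c t y t≤c with y <? c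
... | yes y<c rewrite <ᵇ-true y<c = refl
... | no y≮c rewrite <ᵇ-false {y} {c} (≮⇒≥ y≮c)
                   | <ᵇ-false {suc y} {t} (≤-trans t≤c (≤-trans (≮⇒≥ y≮c) (n≤1+n y)))
                   | <ᵇ-false {y} {t} (≤-trans t≤c (≮⇒≥ y≮c)) = refl

punchIn-<ᵇ-above : ∀ c t y → c < t → (punchIn c y <ᵇ t) ≡ (y <ᵇ pred t)
punchIn-<ᵇ-above c (suc t) y (s≤s c≤t) with y <? c
... | yes y<c rewrite <ᵇ-true y<c | <ᵇ-true {y} {suc t} (≤-trans y<c (≤-trans c≤t (n≤1+n t)))
                    | <ᵇ-true {y} {t} (≤-trans y<c c≤t) = refl
... | no y≮c rewrite <ᵇ-false {y} {c} (≮⇒≥ y≮c) = refl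

punchIn-<ᵇ-punchIn : ∀ c y v → (punchIn c y <ᵇ punchIn c v) ≡ (y <ᵇ v)
punchIn-<ᵇ-punchIn c y v with y <? c | v <? c
... | yes y<c | yes v<c rewrite <ᵇ-true y<c | <ᵇ-true v<c = refl
... | yes y<c | no v≮c rewrite <ᵇ-true y<c | <ᵇ-false {v} {c} (≮⇒≥ v≮c)
        | <ᵇ-true {y} {suc v} (≤-trans y<c (≤-trans (≮⇒≥ v≮c) (n≤1+n v)))
        | <ᵇ-true {y} {v} (≤-trans y<c (≮⇒≥ v≮c)) = refl
... | no y≮c | yes v<c rewrite <ᵇ-false {y} {c} (≮⇒≥ y≮c) | <ᵇ-true v<c
        | <ᵇ-false {suc y} {v} (≤-trans (<⇒≤ v<c) (≤-trans (≮⇒≥ y≮c) (n≤1+n y)))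
        | <ᵇ-false {y} {v} (≤-trans (<⇒≤ v<c) (≮⇒≥ y≮c)) = refl
... | no y≮c | no v≮c rewrite <ᵇ-false {y} {c} (≮⇒≥ y≮c) | <ᵇ-false {v} {c} (≮⇒≥ v≮c) = refl

at-removeAt-range : ∀ a l c x → suc x < l → at (removeAt (range a l) (suc c)) (suc x) ≡ a + punchIn c x
at-removeAt-range a (suc l) zero x (s≤s x<l) = trans (at-range (suc a) l x x<l) (sym (+-suc a x))
at-removeAt-range a (suc l) (suc c) zero _ = sym (+-identityʳ a)
at-removeAt-range a (suc l) (suc c) (suc x) (s≤s x<l) =
  trans (at-removeAt-range (suc a) l c x x<l)
        (trans (sym (+-suc a (punchIn c x))) (cong (a +_) (punchIn-suc c x)))

-- The path α((𝒫ₙ₊₁ , s))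

mapLabelsL-chain : ∀ f σ → mapLabelsL f (chain σ) ≡ chain (map f σ)
mapLabelsL-chain f [] = refl
mapLabelsL-chain f (x ∷ xs) = cong (λ ts → node (f x) ts ∷ []) (mapLabelsL-chain f xs)

relabel-pathTree : ∀ k c σ {A : List ℕ} {Q : OTree} → A ≡ range 1 (suc k) → Q ≡ pathTree σ →
  1 ≤ c → c ≤ suc k → All (λ x → 1 ≤ x × x ≤ k) σ →
  relabel (at A (suc (c ∸ 1))) (at (removeAt A (suc (c ∸ 1)))) Q ≡ node c (chain (map (punchIn c) σ))
relabel-pathTree k (suc c) σ refl refl _ (s≤s c≤k) σ⊆[k] =
  cong₂ node (at-range 1 (suc k) c (s≤s c≤k))
    (trans (mapLabelsL-chain _ σ) (cong chain (map-cong-local (All.map relabel≗punchIn σ⊆[k]))))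
  where
  relabel≗punchIn : ∀ {x} → 1 ≤ x × x ≤ k → at (removeAt (range 1 (suc k)) (suc c)) x ≡ punchIn (suc c) x
  relabel≗punchIn {suc x} (_ , x<k) = trans (at-removeAt-range 1 (suc k) c x (s≤s x<k)) (punchIn-suc c x)

pathLabels : ℕ → List ℕ → List ℕ
pathLabels zero s = []
pathLabels (suc k) s = at s (suc (suc k)) ∷ map (punchIn (at s (suc (suc k)))) (pathLabels k (take (suc k) s))

length-pathLabels : ∀ n s → length (pathLabels n s) ≡ n
length-pathLabels zero s = refl
length-pathLabels (suc k) s =
  cong suc (trans (length-map _ (pathLabels k (take (suc k) s))) (length-pathLabels k _))

pathLabels-bounded : ∀ n s → Subdiagonal n s → All (λ x → 1 ≤ x × x ≤ n) (pathLabels n s)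
pathLabels-bounded zero s g = []
pathLabels-bounded (suc k) s g =
  Subdiagonal-last g
  ∷ map⁺ (All.map (λ {x} (1≤x , x≤k) → punchIn-bounded (at s (suc (suc k))) k x 1≤x x≤k)
                  (pathLabels-bounded k (take (suc k) s) (Subdiagonal-take k s g)))

α-pathLabels : ∀ n s → Subdiagonal n s → α (suc n) s ≡ pathTree (pathLabels n s)
α-pathLabels zero s g = refl
α-pathLabels (suc k) s g
  rewrite compsGo-connected (highlighted (suc (suc k)) (take (suc k) s)) 1 k 1 (highlighted-prefix k s g) =
  cong (λ t → node 0 (t ∷ []))
    (relabel-pathTree k c σ′ drivers≡ (trans (cong (alphaF (suc k) (suc k)) prefix≡) (α-pathLabels k s′ g′))
      (proj₁ (Subdiagonal-last g)) (proj₂ (Subdiagonal-last g)) (pathLabels-bounded k s′ g′))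
  where
  c = at s (suc (suc k))
  s′ = take (suc k) s
  σ′ = pathLabels k s′
  g′ = Subdiagonal-take k s g
  inPrefix : ℕ → Bool
  inPrefix x = (1 ≤ᵇ x) ∧ (x ≤ᵇ suc k)
  inPrefix-true : ∀ {x} → 1 ≤ x × x ≤ suc k → inPrefix x ≡ true
  inPrefix-true (1≤x , x≤k) = cong₂ _∧_ (≤ᵇ-true 1≤x) (≤ᵇ-true x≤k)
  drivers≡ : filterB (λ j → inPrefix (at s j)) (range 1 (suc k)) ≡ range 1 (suc k)
  drivers≡ = filterB-all _ _ (All-range 1 (suc k) λ j 1≤j j≤k →
               inPrefix-true (Subdiagonal-bounded g j 1≤j (<⇒≤ j≤k)))
  prefix≡ : map (λ x → x ∸ 0) (filterB inPrefix s′) ≡ s′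
  prefix≡ = trans (map-id _) (filterB-all _ _ (at⇒All s′ λ i 1≤i i≤l →
              let i≤k = subst (i ≤_) (Subdiagonal.length≡ g′) i≤l in
              subst (λ x → inPrefix x ≡ true) (sym (at-take (suc k) s i i≤k))
                    (inPrefix-true (Subdiagonal-bounded g i 1≤i (≤-trans i≤k (n≤1+n _))))))

-- Inversion counts of the path labels

-- Counting form of "σ is a permutation of [k]".
IsPermutationCount : ℕ → List ℕ → Set
IsPermutationCount k σ = ∀ t → countB (_<ᵇ t) σ ≡ (t ∸ 1) ⊓ k

cons-punchIn-permutation : ∀ k c σ → 1 ≤ c → c ≤ suc k →
  IsPermutationCount k σ → IsPermutationCount (suc k) (c ∷ map (punchIn c) σ)
cons-punchIn-permutation k c σ 1≤c c≤k perm t with c <? t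
... | yes c<t rewrite <ᵇ-true c<t = count-above t c<t
  where
  count-above : ∀ t → c < t → suc (countB (_<ᵇ t) (map (punchIn c) σ)) ≡ (t ∸ 1) ⊓ suc k
  count-above (suc zero) (s≤s c≤0) = contradiction c≤0 (<⇒≱ 1≤c)
  count-above (suc (suc t)) c<t = cong suc (begin
    countB (_<ᵇ suc (suc t)) (map (punchIn c) σ)  ≡⟨ countB-map _ (punchIn c) σ ⟩
    countB (λ y → punchIn c y <ᵇ suc (suc t)) σ   ≡⟨ countB-cong σ (λ y → punchIn-<ᵇ-above c _ y c<t) ⟩
    countB (_<ᵇ suc t) σ                          ≡⟨ perm (suc t) ⟩
    t ⊓ k                                         ∎)
    where open ≡-Reasoning
... | no c≮t rewrite <ᵇ-false {c} {t} (≮⇒≥ c≮t) = begin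
    countB (_<ᵇ t) (map (punchIn c) σ)  ≡⟨ countB-map _ (punchIn c) σ ⟩
    countB (λ y → punchIn c y <ᵇ t) σ   ≡⟨ countB-cong σ (λ y → punchIn-<ᵇ-below c t y (≮⇒≥ c≮t)) ⟩
    countB (_<ᵇ t) σ                    ≡⟨ perm t ⟩
    (t ∸ 1) ⊓ k                         ≡⟨ m≤n⇒m⊓n≡m t∸1≤k ⟩
    t ∸ 1                               ≡⟨ m≤n⇒m⊓n≡m (≤-trans t∸1≤k (n≤1+n k)) ⟨
    (t ∸ 1) ⊓ suc k                     ∎
  where
  open ≡-Reasoning
  t∸1≤k : t ∸ 1 ≤ k
  t∸1≤k = ∸-monoˡ-≤ 1 (≤-trans (≮⇒≥ c≮t) c≤k)

pathLabels-permutation : ∀ n s → Subdiagonal n s → IsPermutationCount n (pathLabels n s)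
pathLabels-permutation zero s g t = sym (⊓-zeroʳ (t ∸ 1))
pathLabels-permutation (suc k) s g =
  cons-punchIn-permutation k (at s (suc (suc k))) (pathLabels k (take (suc k) s)) (proj₁ (Subdiagonal-last g)) (proj₂ (Subdiagonal-last g))
    (pathLabels-permutation k (take (suc k) s) (Subdiagonal-take k s g))

inversionsAfter : List ℕ → ℕ → ℕ
inversionsAfter σ q = countB (_<ᵇ at σ q) (drop q σ)

inversionsAfter-interval : ∀ σ q →
  countB (λ j → at σ j <ᵇ at σ q) (interval (suc q) (length σ)) ≡ inversionsAfter σ q
inversionsAfter-interval σ q = trans
  (sym (countB-map (_<ᵇ at σ q) (at σ) (range (suc q) (length σ ∸ q))))
  (cong (countB (_<ᵇ at σ q)) (map-at-range σ q))

inversionsAfter-cons : ∀ c σ q → 1 ≤ q → inversionsAfter (c ∷ σ) (suc q) ≡ inversionsAfter σ q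
inversionsAfter-cons c σ (suc q) _ = refl

inversionsAfter-punchIn : ∀ c σ q → 1 ≤ c → inversionsAfter (map (punchIn c) σ) q ≡ inversionsAfter σ q
inversionsAfter-punchIn (suc c) σ q _
  rewrite at-map (punchIn (suc c)) refl σ q | drop-map {f = punchIn (suc c)} q σ =
  trans (countB-map _ (punchIn (suc c)) (drop q σ))
        (countB-cong (drop q σ) (λ y → punchIn-<ᵇ-punchIn (suc c) y (at σ q)))

-- The values sᵢ, read backwards from i = n + 1, form the Lehmer code of σ.
pathLabels-inversions : ∀ n s → Subdiagonal n s → ∀ i → i < n →
  at s (suc (suc i)) ≡ suc (inversionsAfter (pathLabels n s) (n ∸ i))
pathLabels-inversions (suc k) s g i (s≤s i≤k) with m≤n⇒m<n∨m≡n i≤k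
... | inj₂ refl rewrite m+n∸n≡m 1 i = sym (begin
    suc (countB (_<ᵇ c) (map (punchIn c) σ′))  ≡⟨ cong suc (countB-map _ (punchIn c) σ′) ⟩
    suc (countB (λ y → punchIn c y <ᵇ c) σ′)   ≡⟨ cong suc (countB-cong σ′ (λ y → punchIn-<ᵇ-below c c y ≤-refl)) ⟩
    suc (countB (_<ᵇ c) σ′)                    ≡⟨ cong suc (pathLabels-permutation i s′ (Subdiagonal-take i s g) c) ⟩
    suc ((c ∸ 1) ⊓ i)                          ≡⟨ cong suc (m≤n⇒m⊓n≡m (∸-monoˡ-≤ 1 (proj₂ (Subdiagonal-last g)))) ⟩
    suc (c ∸ 1)                                ≡⟨ m+[n∸m]≡n (proj₁ (Subdiagonal-last g)) ⟩
    c                                          ∎)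
  where
  open ≡-Reasoning
  c = at s (suc (suc i))
  s′ = take (suc i) s
  σ′ = pathLabels i s′
... | inj₁ i<k rewrite 1+m∸n≡1+[m∸n] i≤k = begin
    at s (suc (suc i))                                     ≡⟨ at-take (suc k) s (suc (suc i)) (s≤s i<k) ⟨
    at s′ (suc (suc i))                                    ≡⟨ pathLabels-inversions k s′ (Subdiagonal-take k s g) i i<k ⟩
    suc (inversionsAfter σ′ (k ∸ i))                       ≡⟨ cong suc (inversionsAfter-punchIn c σ′ (k ∸ i) (proj₁ (Subdiagonal-last g))) ⟨
    suc (inversionsAfter (map (punchIn c) σ′) (k ∸ i))     ≡⟨ cong suc (inversionsAfter-cons c _ (k ∸ i) (m<n⇒0<n∸m i<k)) ⟨
    suc (inversionsAfter (c ∷ map (punchIn c) σ′) (suc (k ∸ i)))   ∎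
  where
  open ≡-Reasoning
  c = at s (suc (suc k))
  s′ = take (suc k) s
  σ′ = pathLabels k s′

lemma5p2 : (n : ℕ) → 1 ≤ n → (s : List ℕ) → length s ≡ suc n →
    All (λ x → 1 ≤ x × x ≤ suc n) s →
    IsParkingPath (suc n) s → IsPrimePath (suc n) s →
    at s 1 ≡ 1 →
    ((i : ℕ) → 2 ≤ i → i ≤ suc n → at s i ≤ i ∸ 1) →
    ∃ λ σ → length σ ≡ n × α (suc n) s ≡ pathTree σ ×
      ((i : ℕ) → 2 ≤ i → i ≤ suc n →
        at s i ≡ suc (countB (λ j → at σ j <ᵇ at σ (suc (suc n) ∸ i))
                             (interval (suc (suc (suc n)) ∸ i) n)))
-- Parking and primality are consequences of the staircase bounds.
lemma5p2 n _ s len s⊆[n+1] _ _ s₁≡1 s≤i-1 =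
  σ , length-pathLabels n s , α-pathLabels n s g , code
  where
  g : Subdiagonal n s
  g = record
    { length≡ = len
    ; first≡1 = s₁≡1
    ; bounded = λ i 2≤i i≤n →
        proj₁ (All⇒at s⊆[n+1] i (<⇒≤ 2≤i) (subst (i ≤_) (sym len) i≤n)) , s≤i-1 i 2≤i i≤n
    }
  σ = pathLabels n s
  code : (i : ℕ) → 2 ≤ i → i ≤ suc n →
    at s i ≡ suc (countB (λ j → at σ j <ᵇ at σ (suc (suc n) ∸ i)) (interval (suc (suc (suc n)) ∸ i) n))
  code (suc zero) (s≤s ()) _
  code (suc (suc i)) _ (s≤s i<n) rewrite 1+m∸n≡1+[m∸n] (<⇒≤ i<n) =
    trans (pathLabels-inversions n s g i i<n)
      (cong suc (sym (subst (λ l → countB (λ j → at σ j <ᵇ at σ (n ∸ i)) (interval (suc (n ∸ i)) l)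
                                     ≡ inversionsAfter σ (n ∸ i))
                            (length-pathLabels n s)
                            (inversionsAfter-interval σ (n ∸ i)))))
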